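{- Let $G=(V,E)$ be a connected interval graph with $n$ vertices, and let $u_1,u_2,\dots,u_n$ be its vertices ordered by increasing left endpoints of the intervals of a fixed interval representation. For $1\le i\le n$ let $V_i=\{u_j : j\le i\}$. Then for every $2\le i\le n-1$, $\gamma_p(G[V_{i+1}])\ge \gamma_p(G[V_i])$.
   Context: An interval graph is a graph having an interval representation, i.e. a family of intervals assigned to the vertices such that two vertices are adjacent iff their intervals intersect. For a graph $H$ without isolated vertices, a set $S$ of vertices is a paired-dominating set if every vertex not in $S$ is adjacent to a vertex of $S$ and $H[S]$ has a perfect matching; $\gamma_p(H)$ is the minimum cardinality of a paired-dominating set of $H$. $G[V_i]$ is the subgraph induced by $V_i$ (it is connected since $G$ is connected). -}

module Defs where

open import Level using (0ℓ)
open import Data.Nat using (ℕ; _≤_)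
open import Data.Fin using (Fin; toℕ; inject≤)
open import Data.Fin.Subset using (Subset; _∈_; _∉_; ∣_∣)
open import Data.Rational using (ℚ) renaming (_≤_ to _≤ℚ_)
open import Data.Product using (Σ; _×_; ∃)
open import Relation.Nullary using (¬_)
open import Relation.Binary.PropositionalEquality using (_≡_)
open import Relation.Binary.Construct.Closure.ReflexiveTransitive using (Star)
open import Function.Bundles using (_⇔_)

record Graph (n : ℕ) : Set₁ where
  field
    Adj   : Fin n → Fin n → Set
    sym   : ∀ {x y} → Adj x y → Adj y x
    irrefl : ∀ {x} → ¬ Adj x x
open Graph public

Connected : ∀ {n} → Graph n → Set
Connected G = ∀ x y → Star (Adj G) x y

prefix : ∀ {n} → Graph n → (k : ℕ) → k ≤ n → Graph k
prefix G k k≤n = record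
  { Adj    = λ a b → Adj G (inject≤ a k≤n) (inject≤ b k≤n)
  ; sym    = sym G
  ; irrefl = irrefl G }

record OrderedIntervalRep {n} (G : Graph n) : Set where
  field
    left right : Fin n → ℚ
    wf        : ∀ x → left x ≤ℚ right x
    ordered   : ∀ x y → toℕ x ≤ toℕ y → left x ≤ℚ left y
    adj⇔meet  : ∀ x y → ¬ x ≡ y → Adj G x y ⇔ (left x ≤ℚ right y × left y ≤ℚ right x)

Dominating : ∀ {m} → Graph m → Subset m → Set
Dominating H S = ∀ v → v ∉ S → ∃ λ w → w ∈ S × Adj H v w

-- H[S] has a perfect matching: a fixed-point-free involution on S along edges.
HasPerfectMatching : ∀ {m} → Graph m → Subset m → Set
HasPerfectMatching {m} H S = Σ (Fin m → Fin m) λ p →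
  ∀ x → x ∈ S → (p x ∈ S) × Adj H x (p x) × (p (p x) ≡ x)

PairedDominating : ∀ {m} → Graph m → Subset m → Set
PairedDominating H S = Dominating H S × HasPerfectMatching H S

IsPairedDomNumber : ∀ {m} → Graph m → ℕ → Set
IsPairedDomNumber H k =
  (∃ λ S → PairedDominating H S × ∣ S ∣ ≡ k) ×
  (∀ S → PairedDominating H S → k ≤ ∣ S ∣)

module Submission where

-- Write H' = G[V_{i+1}], H = G[V_i] = H' − w where w = u_{i+1} is the
-- last vertex.  Since w has the largest left endpoint, its neighbours in H all
-- contain left(w) and hence form a clique (w is simplicial).  From any
-- paired-dominating set S of H' we build one of H of size at most |S|:
--   * w ∉ S:  S itself, read inside H;
--   * w ∈ S, matched to x:  let M = S − {w, x}, still perfectly matched.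
--     If x has a neighbour y ∉ M, take M ∪ {x, y} with the new pair xy;
--     otherwise all neighbours of x lie in M and M alone dominates H (x needs
--     a neighbour in H, which connectivity and i ≥ 2 provide).
--   Neighbours of w are dominated by x thanks to simpliciality.

open import Defs
open import Data.Nat using (ℕ; zero; suc; _+_; _≤_; _<_; z≤n; s≤s)
open import Data.Nat.Properties
  using (≤-trans; n≤1+n; +-suc; +-monoʳ-≤; +-monoˡ-≤; ≤-reflexive; <⇒≤; <-trans; <-irrefl;
         ≰⇒>; m≤n+m)
open import Data.Fin using (Fin; toℕ; inject≤; inject₁; fromℕ; fromℕ<)
open import Data.Fin.Properties
  using (_≟_; toℕ-injective; toℕ-inject≤; toℕ-inject₁; toℕ-fromℕ; toℕ-fromℕ<; toℕ<n;
         inject₁-injective; fromℕ≢inject₁; any?)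
open import Data.Fin.Relation.Unary.Top using (view; ‵fromℕ; ‵inject₁; view-inject₁)
open import Data.Fin.Subset using (Subset; _∈_; _∉_; ∣_∣; inside; outside; _∪_; _-_; ⁅_⁆)
open import Data.Fin.Subset.Properties
  using (_∈?_; x∈p∪q⁺; x∈p∪q⁻; x∈⁅x⁆; x∈⁅y⁆⇒x≡y; ∣⁅x⁆∣≡1;
         x∈p∧x≢y⇒x∈p-y; p─q⊆p; x∈p⇒∣p-x∣<∣p∣)
open import Data.Vec using ([]; _∷_; here; there)
open import Data.Rational using () renaming (_≤_ to _≤ℚ_; _<_ to _<ℚ_)
import Data.Rational.Properties as ℚ
open import Data.Product using (_×_; ∃; ∃₂; _,_; proj₁; proj₂)
open import Data.Sum using (_⊎_; inj₁; inj₂)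
open import Function using (_∘_)
open import Function.Bundles using (Equivalence)
open import Relation.Nullary using (¬_; Dec; yes; no; contradiction)
open import Relation.Nullary.Decidable using (_×-dec_; ¬?)
open import Relation.Binary.PropositionalEquality
  using (_≡_; _≢_; refl; cong; cong₂; subst; subst₂; trans; module ≡-Reasoning)
  renaming (sym to ≡-sym)
open import Relation.Binary.Construct.Closure.ReflexiveTransitive using (Star; ε; _◅_)

∣p∪q∣≤∣p∣+∣q∣ : ∀ {k} (p q : Subset k) → ∣ p ∪ q ∣ ≤ ∣ p ∣ + ∣ q ∣
∣p∪q∣≤∣p∣+∣q∣ []            []            = z≤n
∣p∪q∣≤∣p∣+∣q∣ (outside ∷ p) (outside ∷ q) = ∣p∪q∣≤∣p∣+∣q∣ p q
∣p∪q∣≤∣p∣+∣q∣ (inside  ∷ p) (outside ∷ q) = s≤s (∣p∪q∣≤∣p∣+∣q∣ p q)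
∣p∪q∣≤∣p∣+∣q∣ (outside ∷ p) (inside  ∷ q) =
  ≤-trans (s≤s (∣p∪q∣≤∣p∣+∣q∣ p q)) (≤-reflexive (≡-sym (+-suc ∣ p ∣ ∣ q ∣)))
∣p∪q∣≤∣p∣+∣q∣ (inside  ∷ p) (inside  ∷ q) =
  s≤s (≤-trans (∣p∪q∣≤∣p∣+∣q∣ p q) (+-monoʳ-≤ ∣ p ∣ (n≤1+n ∣ q ∣)))

x∉p-x : ∀ {k} (p : Subset k) (x : Fin k) → x ∉ p - x
x∉p-x (_ ∷ p) Fin.zero    ()
x∉p-x (_ ∷ p) (Fin.suc x) (there x∈) = x∉p-x p x x∈

withPair : ∀ {k} → Fin k → Fin k → Subset k → Subset k
withPair x y M = (⁅ x ⁆ ∪ ⁅ y ⁆) ∪ M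

x∈withPair : ∀ {k} {x y : Fin k} (M : Subset k) → x ∈ withPair x y M
x∈withPair {x = x} M = x∈p∪q⁺ (inj₁ (x∈p∪q⁺ (inj₁ (x∈⁅x⁆ x))))

y∈withPair : ∀ {k} {x y : Fin k} (M : Subset k) → y ∈ withPair x y M
y∈withPair {y = y} M = x∈p∪q⁺ (inj₁ (x∈p∪q⁺ (inj₂ (x∈⁅x⁆ y))))

M⊆withPair : ∀ {k} {x y a : Fin k} {M : Subset k} → a ∈ M → a ∈ withPair x y M
M⊆withPair a∈M = x∈p∪q⁺ (inj₂ a∈M)

∈withPair⁻ : ∀ {k} {x y a : Fin k} (M : Subset k) → a ∈ withPair x y M → a ≡ x ⊎ a ≡ y ⊎ a ∈ M
∈withPair⁻ {x = x} {y} M a∈ with x∈p∪q⁻ (⁅ x ⁆ ∪ ⁅ y ⁆) M a∈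
... | inj₂ a∈M = inj₂ (inj₂ a∈M)
... | inj₁ a∈xy with x∈p∪q⁻ ⁅ x ⁆ ⁅ y ⁆ a∈xy
...   | inj₁ a∈x = inj₁ (x∈⁅y⁆⇒x≡y x a∈x)
...   | inj₂ a∈y = inj₂ (inj₁ (x∈⁅y⁆⇒x≡y y a∈y))

∣withPair∣ : ∀ {k} (x y : Fin k) (M : Subset k) → ∣ withPair x y M ∣ ≤ 2 + ∣ M ∣
∣withPair∣ x y M = ≤-trans (∣p∪q∣≤∣p∣+∣q∣ (⁅ x ⁆ ∪ ⁅ y ⁆) M) (+-monoˡ-≤ ∣ M ∣ ∣xy∣≤2)
  where
  ∣xy∣≤2 : ∣ ⁅ x ⁆ ∪ ⁅ y ⁆ ∣ ≤ 2
  ∣xy∣≤2 = ≤-trans (∣p∪q∣≤∣p∣+∣q∣ ⁅ x ⁆ ⁅ y ⁆)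
                   (≤-reflexive (cong₂ _+_ (∣⁅x⁆∣≡1 x) (∣⁅x⁆∣≡1 y)))

dropLast : ∀ {k} → Subset (suc k) → Subset k
dropLast {zero}  _       = []
dropLast {suc k} (b ∷ p) = b ∷ dropLast p

∈dropLast⁺ : ∀ {k} (p : Subset (suc k)) {a : Fin k} → inject₁ a ∈ p → a ∈ dropLast p
∈dropLast⁺ {suc k} (b ∷ p) {Fin.zero}  here       = here
∈dropLast⁺ {suc k} (b ∷ p) {Fin.suc a} (there a∈) = there (∈dropLast⁺ p a∈)

∈dropLast⁻ : ∀ {k} (p : Subset (suc k)) {a : Fin k} → a ∈ dropLast p → inject₁ a ∈ p
∈dropLast⁻ {suc k} (b ∷ p) {Fin.zero}  here       = here
∈dropLast⁻ {suc k} (b ∷ p) {Fin.suc a} (there a∈) = there (∈dropLast⁻ p a∈)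

∣dropLast∣≤ : ∀ {k} (p : Subset (suc k)) → ∣ dropLast p ∣ ≤ ∣ p ∣
∣dropLast∣≤ {zero}  (b ∷ [])      = z≤n
∣dropLast∣≤ {suc k} (outside ∷ p) = ∣dropLast∣≤ p
∣dropLast∣≤ {suc k} (inside  ∷ p) = s≤s (∣dropLast∣≤ p)

∣dropLast∣< : ∀ {k} (p : Subset (suc k)) → fromℕ k ∈ p → suc ∣ dropLast p ∣ ≤ ∣ p ∣
∣dropLast∣< {zero}  (inside  ∷ []) here       = s≤s z≤n
∣dropLast∣< {suc k} (outside ∷ p)  (there k∈) = ∣dropLast∣< p k∈
∣dropLast∣< {suc k} (inside  ∷ p)  (there k∈) = s≤s (∣dropLast∣< p k∈)

shrink : ∀ {k} → Fin k → Fin (suc k) → Fin k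
shrink d c with view c
... | ‵fromℕ      = d
... | ‵inject₁ c′ = c′

shrink-inject₁ : ∀ {k} (d a : Fin k) → shrink d (inject₁ a) ≡ a
shrink-inject₁ d a rewrite view-inject₁ a = refl

inject≤-inject₁ : ∀ {k n} (a : Fin k) .(k+1≤n : suc k ≤ n) .(k≤n : k ≤ n) →
  inject≤ (inject₁ a) k+1≤n ≡ inject≤ a k≤n
inject≤-inject₁ a k+1≤n k≤n = toℕ-injective (begin
  toℕ (inject≤ (inject₁ a) k+1≤n) ≡⟨ toℕ-inject≤ (inject₁ a) k+1≤n ⟩
  toℕ (inject₁ a)                 ≡⟨ toℕ-inject₁ a ⟩
  toℕ a                           ≡⟨ toℕ-inject≤ a k≤n ⟨
  toℕ (inject≤ a k≤n)             ∎)
  where open ≡-Reasoning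

anotherVertex : ∀ {k} → 2 ≤ k → (x : Fin k) → ∃ λ y → y ≢ x
anotherVertex (s≤s (s≤s _)) Fin.zero    = Fin.suc Fin.zero , λ ()
anotherVertex (s≤s (s≤s _)) (Fin.suc x) = Fin.zero , λ ()

IsPairing : ∀ {m} → Graph m → Subset m → (Fin m → Fin m) → Set
IsPairing H S p = ∀ x → x ∈ S → (p x ∈ S) × Adj H x (p x) × (p (p x) ≡ x)

pairedWith : ∀ {m} (H : Graph m) (T : Subset m) (q : Fin m → Fin m) {a b} →
  q a ≡ b → b ∈ T → Adj H a b → q b ≡ a → (q a ∈ T) × Adj H a (q a) × (q (q a) ≡ a)
pairedWith H T q refl b∈T a~b qb≡a = b∈T , a~b , qb≡a

extendMatching : ∀ {m} (H : Graph m) {M : Subset m} {x y : Fin m} →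
  x ∉ M → y ∉ M → Adj H x y → HasPerfectMatching H M → HasPerfectMatching H (withPair x y M)
extendMatching {m} H {M} {x} {y} x∉M y∉M x~y (q , pairing) = q′ , pairing′
  where
  x≢y : x ≢ y
  x≢y refl = irrefl H x~y

  q′ : Fin m → Fin m
  q′ a with a ≟ x | a ≟ y
  ... | yes _ | _     = y
  ... | no _  | yes _ = x
  ... | no _  | no _  = q a

  q′x : q′ x ≡ y
  q′x with x ≟ x
  ... | yes _   = refl
  ... | no x≢x = contradiction refl x≢x

  q′y : q′ y ≡ x
  q′y with y ≟ x | y ≟ y
  ... | yes y≡x | _       = contradiction (≡-sym y≡x) x≢y
  ... | no _    | yes _   = refl
  ... | no _    | no y≢y = contradiction refl y≢y

  q′-M : ∀ {a} → a ∈ M → q′ a ≡ q a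
  q′-M {a} a∈M with a ≟ x | a ≟ y
  ... | yes refl | _        = contradiction a∈M x∉M
  ... | no _     | yes refl = contradiction a∈M y∉M
  ... | no _     | no _     = refl

  pairing′ : IsPairing H (withPair x y M) q′
  pairing′ a a∈ with ∈withPair⁻ M a∈
  ... | inj₁ refl        = pairedWith H (withPair x y M) q′ q′x (y∈withPair M) x~y q′y
  ... | inj₂ (inj₁ refl) = pairedWith H (withPair x y M) q′ q′y (x∈withPair M) (sym H x~y) q′x
  ... | inj₂ (inj₂ a∈M)  with pairing a a∈M
  ...   | qa∈M , a~qa , qqa≡a =
          pairedWith H (withPair x y M) q′ (q′-M a∈M) (M⊆withPair qa∈M) a~qa (trans (q′-M qa∈M) qqa≡a)

pairedDomNumber-mono : ∀ {k l} {H : Graph k} {H′ : Graph l} →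
  (∀ S → PairedDominating H′ S → ∃ λ T → PairedDominating H T × ∣ T ∣ ≤ ∣ S ∣) →
  ∀ {a b} → IsPairedDomNumber H a → IsPairedDomNumber H′ b → a ≤ b
pairedDomNumber-mono trade (_ , minimal) ((S , pdS , refl) , _) with trade S pdS
... | T , pdT , ∣T∣≤∣S∣ = ≤-trans (minimal T pdT) ∣T∣≤∣S∣

module DeleteSimplicialLast {k} (H : Graph k) (H′ : Graph (suc k))
  (restrict    : ∀ {a b} → Adj H′ (inject₁ a) (inject₁ b) → Adj H a b)
  (adj?        : ∀ a b → Dec (Adj H a b))
  (simplicial  : ∀ {u v} → u ≢ v → Adj H′ (inject₁ u) (fromℕ k) →
                 Adj H′ (inject₁ v) (fromℕ k) → Adj H u v)
  (nonIsolated : ∀ x → Adj H′ (inject₁ x) (fromℕ k) → ∃ λ z → Adj H x z)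
  where

  last : Fin (suc k)
  last = fromℕ k

  restrictMatching : ∀ {S T} (p : Fin (suc k) → Fin (suc k)) → IsPairing H′ S p →
    (∀ {a} → a ∈ T → inject₁ a ∈ S) →
    (∀ {a} → a ∈ T → ∃ λ b → p (inject₁ a) ≡ inject₁ b × b ∈ T) →
    HasPerfectMatching H T
  restrictMatching {S} {T} p pairing T⊆S partnerInT = q , pairs
    where
    q : Fin k → Fin k
    q a = shrink a (p (inject₁ a))

    pairs : IsPairing H T q
    pairs a a∈T with partnerInT a∈T | pairing (inject₁ a) (T⊆S a∈T)
    ... | b , pa≡b , b∈T | _ , a~pa , ppa≡a =
      pairedWith H T q qa≡b b∈T (restrict (subst (Adj H′ (inject₁ a)) pa≡b a~pa)) qb≡a
      where
      qa≡b : q a ≡ b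
      qa≡b = trans (cong (shrink a) pa≡b) (shrink-inject₁ a b)
      qb≡a : q b ≡ a
      qb≡a = trans (cong (shrink b) (trans (cong p (≡-sym pa≡b)) ppa≡a)) (shrink-inject₁ b a)

  module Trade {S : Subset (suc k)} (dom : Dominating H′ S)
               (p : Fin (suc k) → Fin (suc k)) (pairing : IsPairing H′ S p) where

    S⁻ : Subset k
    S⁻ = dropLast S

    partnerIn : ∀ {c} → c ∈ S → p c ∈ S
    partnerIn c∈S = proj₁ (pairing _ c∈S)

    partnerAdj : ∀ {c} → c ∈ S → Adj H′ c (p c)
    partnerAdj c∈S = proj₁ (proj₂ (pairing _ c∈S))

    partnerInvol : ∀ {c} → c ∈ S → p (p c) ≡ c
    partnerInvol c∈S = proj₂ (proj₂ (pairing _ c∈S))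

    lowerMember : ∀ {c} → c ∈ S → c ≢ last → ∃ λ b → c ≡ inject₁ b × b ∈ S⁻
    lowerMember {c} c∈S c≢last with view c
    ... | ‵fromℕ     = contradiction refl c≢last
    ... | ‵inject₁ b = b , refl , ∈dropLast⁺ S c∈S

    whenLastUnused : last ∉ S → ∃ λ T → PairedDominating H T × ∣ T ∣ ≤ ∣ S ∣
    whenLastUnused last∉S =
      S⁻ , (dominating , restrictMatching p pairing (∈dropLast⁻ S) partnerBelow) , ∣dropLast∣≤ S
      where
      notLast : ∀ {c} → c ∈ S → c ≢ last
      notLast c∈S refl = last∉S c∈S

      dominating : Dominating H S⁻
      dominating v v∉S⁻ with dom (inject₁ v) (v∉S⁻ ∘ ∈dropLast⁺ S)
      ... | c , c∈S , v~c with lowerMember c∈S (notLast c∈S)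
      ...   | b , refl , b∈S⁻ = b , b∈S⁻ , restrict v~c

      partnerBelow : ∀ {a} → a ∈ S⁻ → ∃ λ b → p (inject₁ a) ≡ inject₁ b × b ∈ S⁻
      partnerBelow a∈S⁻ = lowerMember pa∈S (notLast pa∈S)
        where pa∈S = partnerIn (∈dropLast⁻ S a∈S⁻)

    module LastMatchedWith (last∈S : last ∈ S) (x : Fin k) (p-last : p last ≡ inject₁ x) where

      p-x : p (inject₁ x) ≡ last
      p-x = trans (cong p (≡-sym p-last)) (partnerInvol last∈S)

      x~last : Adj H′ (inject₁ x) last
      x~last = sym H′ (subst (Adj H′ last) p-last (partnerAdj last∈S))

      M : Subset k
      M = S⁻ - x

      x∉M : x ∉ M
      x∉M = x∉p-x S⁻ x

      M⊆S : ∀ {a} → a ∈ M → inject₁ a ∈ S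
      M⊆S = ∈dropLast⁻ S ∘ p─q⊆p S⁻ ⁅ x ⁆

      M-size : 2 + ∣ M ∣ ≤ ∣ S ∣
      M-size = ≤-trans (s≤s (x∈p⇒∣p-x∣<∣p∣ (∈dropLast⁺ S (subst (_∈ S) p-last (partnerIn last∈S)))))
                       (∣dropLast∣< S last∈S)

      -- Vertices of M are matched neither to w nor to x, so M stays matched.
      partner≢last : ∀ {a} → inject₁ a ∈ S → a ≢ x → p (inject₁ a) ≢ last
      partner≢last {a} a∈S a≢x pa≡last = a≢x (inject₁-injective (begin
        inject₁ a           ≡⟨ partnerInvol a∈S ⟨
        p (p (inject₁ a))   ≡⟨ cong p pa≡last ⟩
        p last              ≡⟨ p-last ⟩
        inject₁ x           ∎))
        where open ≡-Reasoning

      partner≢x : ∀ {a b} → inject₁ a ∈ S → p (inject₁ a) ≡ inject₁ b → b ≢ x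
      partner≢x {a} a∈S pa≡b refl = fromℕ≢inject₁ (begin
        last                ≡⟨ p-x ⟨
        p (inject₁ x)       ≡⟨ cong p pa≡b ⟨
        p (p (inject₁ a))   ≡⟨ partnerInvol a∈S ⟩
        inject₁ a           ∎)
        where open ≡-Reasoning

      M-matching : HasPerfectMatching H M
      M-matching = restrictMatching p pairing M⊆S partnerInM
        where
        partnerInM : ∀ {a} → a ∈ M → ∃ λ b → p (inject₁ a) ≡ inject₁ b × b ∈ M
        partnerInM {a} a∈M = within (lowerMember (partnerIn a∈S) (partner≢last a∈S a≢x))
          where
          a∈S : inject₁ a ∈ S
          a∈S = M⊆S a∈M
          a≢x : a ≢ x
          a≢x refl = x∉M a∈M
          within : (∃ λ b → p (inject₁ a) ≡ inject₁ b × b ∈ S⁻) →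
                   ∃ λ b → p (inject₁ a) ≡ inject₁ b × b ∈ M
          within (b , pa≡b , b∈S⁻) = b , pa≡b , x∈p∧x≢y⇒x∈p-y b∈S⁻ (partner≢x a∈S pa≡b)

      -- A vertex v ∉ M ∪ {x} sees x or M: its dominator is w (then v ~ x by
      -- simpliciality), x itself, or a vertex of M.
      seesXOrM : ∀ {v} → v ∉ M → v ≢ x → Adj H v x ⊎ ∃ λ u → u ∈ M × Adj H v u
      seesXOrM {v} v∉M v≢x with dom (inject₁ v) (λ v∈S → v∉M (x∈p∧x≢y⇒x∈p-y (∈dropLast⁺ S v∈S) v≢x))
      ... | c , c∈S , v~c with view c
      ...   | ‵fromℕ      = inj₁ (simplicial v≢x v~c x~last)
      ...   | ‵inject₁ c′ with c′ ≟ x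
      ...     | yes refl  = inj₁ (restrict v~c)
      ...     | no c′≢x   = inj₂ (c′ , x∈p∧x≢y⇒x∈p-y (∈dropLast⁺ S c∈S) c′≢x , restrict v~c)

      withFreeNeighbour : ∀ {y} → y ∉ M → Adj H x y → ∃ λ T → PairedDominating H T × ∣ T ∣ ≤ ∣ S ∣
      withFreeNeighbour {y} y∉M x~y =
        T , (dominating , extendMatching H x∉M y∉M x~y M-matching) , ≤-trans (∣withPair∣ x y M) M-size
        where
        T : Subset k
        T = withPair x y M

        dominating : Dominating H T
        dominating v v∉T with seesXOrM (v∉T ∘ M⊆withPair) (λ { refl → v∉T (x∈withPair M) })
        ... | inj₁ v~x             = x , x∈withPair M , v~x
        ... | inj₂ (u , u∈M , v~u) = u , M⊆withPair u∈M , v~u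

      withoutFreeNeighbour : ¬ (∃ λ y → y ∉ M × Adj H x y) →
                             ∃ λ T → PairedDominating H T × ∣ T ∣ ≤ ∣ S ∣
      withoutFreeNeighbour noFree = M , (dominating , M-matching) , ≤-trans (m≤n+m ∣ M ∣ 2) M-size
        where
        neighbourInM : ∀ {y} → Adj H x y → y ∈ M
        neighbourInM {y} x~y with y ∈? M
        ... | yes y∈M = y∈M
        ... | no y∉M  = contradiction (y , y∉M , x~y) noFree

        dominating : Dominating H M
        dominating v v∉M with v ≟ x
        ... | yes refl = let (z , x~z) = nonIsolated x x~last in z , neighbourInM x~z , x~z
        ... | no v≢x with seesXOrM v∉M v≢x
        ...   | inj₁ v~x = contradiction (neighbourInM (sym H v~x)) v∉M
        ...   | inj₂ seen = seen

      result : ∃ λ T → PairedDominating H T × ∣ T ∣ ≤ ∣ S ∣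
      result with any? (λ y → ¬? (y ∈? M) ×-dec adj? x y)
      ... | yes (y , y∉M , x~y) = withFreeNeighbour y∉M x~y
      ... | no noFree           = withoutFreeNeighbour noFree

    whenLastUsed : last ∈ S → ∃ λ T → PairedDominating H T × ∣ T ∣ ≤ ∣ S ∣
    whenLastUsed last∈S with lowerMember (partnerIn last∈S) partner≢last
      where
      partner≢last : p last ≢ last
      partner≢last e = irrefl H′ (subst (Adj H′ last) e (partnerAdj last∈S))
    ... | x , p-last , _ = LastMatchedWith.result last∈S x p-last

  trade : ∀ S → PairedDominating H′ S → ∃ λ T → PairedDominating H T × ∣ T ∣ ≤ ∣ S ∣
  trade S (dom , p , pairing) with last ∈? S
  ... | yes last∈S = Trade.whenLastUsed dom p pairing last∈S
  ... | no last∉S  = Trade.whenLastUnused dom p pairing last∉S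

walkLeaves : ∀ {A : Set} {R : A → A → Set} (P : A → Set) → (∀ a → Dec (P a)) →
  ∀ {a b} → Star R a b → P a → ¬ P b → ∃₂ λ z z′ → R z z′ × P z × ¬ P z′
walkLeaves P P? ε              Pa ¬Pb = contradiction Pa ¬Pb
walkLeaves P P? (_◅_ {j = m} r rest) Pa ¬Pb with P? m
... | yes Pm = walkLeaves P P? rest Pm ¬Pb
... | no ¬Pm = _ , m , r , Pa , ¬Pm

module IntervalGraph {n} (G : Graph n) (rep : OrderedIntervalRep G) where
  open OrderedIntervalRep rep

  adj⇒≢ : ∀ {u v} → Adj G u v → u ≢ v
  adj⇒≢ u~v refl = irrefl G u~v

  intersect : ∀ {u v} → Adj G u v → left u ≤ℚ right v × left v ≤ℚ right u
  intersect {u} {v} u~v = Equivalence.to (adj⇔meet u v (adj⇒≢ u~v)) u~v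

  adjacent : ∀ {u v} → u ≢ v → left u ≤ℚ right v → left v ≤ℚ right u → Adj G u v
  adjacent {u} {v} u≢v lu≤rv lv≤ru = Equivalence.from (adj⇔meet u v u≢v) (lu≤rv , lv≤ru)

  adj? : ∀ u v → Dec (Adj G u v)
  adj? u v with u ≟ v
  ... | yes refl = no (irrefl G)
  ... | no u≢v with left u ℚ.≤? right v | left v ℚ.≤? right u
  ...   | yes lu≤rv | yes lv≤ru = yes (adjacent u≢v lu≤rv lv≤ru)
  ...   | no lu≰rv  | _         = no (lu≰rv ∘ proj₁ ∘ intersect)
  ...   | _         | no lv≰ru  = no (lv≰ru ∘ proj₂ ∘ intersect)

  -- Neighbours of w preceding w are pairwise adjacent: both intervals contain left w.
  earlierNeighboursAdjacent : ∀ {u v w} → toℕ u ≤ toℕ w → toℕ v ≤ toℕ w → u ≢ v →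
    Adj G u w → Adj G v w → Adj G u v
  earlierNeighboursAdjacent {u} {v} {w} u≤w v≤w u≢v u~w v~w =
    adjacent u≢v (ℚ.≤-trans (ordered u w u≤w) (proj₂ (intersect v~w)))
                 (ℚ.≤-trans (ordered v w v≤w) (proj₂ (intersect u~w)))

  -- If some interval lies entirely left of x's, a walk to x must enter x's
  -- interval from the left, producing a neighbour of x that precedes x.
  earlierNeighbour : Connected G → ∀ {x y} → right y <ℚ left x →
    ∃ λ z → toℕ z < toℕ x × Adj G x z
  earlierNeighbour conn {x} {y} ry<lx
    with walkLeaves (λ z → right z <ℚ left x) (λ z → right z ℚ.<? left x) (conn y x) ry<lx
                    (λ rx<lx → ℚ.<-irrefl refl (ℚ.<-≤-trans rx<lx (wf x)))
  ... | z , z′ , z~z′ , rz<lx , rz′≮lx = z′ , z′<x , adjacent x≢z′ (ℚ.≮⇒≥ rz′≮lx) lz′≤rx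
    where
    lz′≤rz : left z′ ≤ℚ right z
    lz′≤rz = proj₂ (intersect z~z′)
    z′<x : toℕ z′ < toℕ x
    z′<x = ≰⇒> (λ x≤z′ → ℚ.<-irrefl refl
             (ℚ.≤-<-trans (ℚ.≤-trans (ordered x z′ x≤z′) lz′≤rz) rz<lx))
    x≢z′ : x ≢ z′
    x≢z′ refl = <-irrefl refl z′<x
    lz′≤rx : left z′ ≤ℚ right x
    lz′≤rx = ℚ.≤-trans lz′≤rz (ℚ.≤-trans (ℚ.<⇒≤ rz<lx) (wf x))

  neighbourBefore : Connected G → ∀ {x y w} → toℕ x < toℕ w → toℕ y < toℕ w → y ≢ x →
    Adj G x w → ∃ λ z → toℕ z < toℕ w × Adj G x z
  neighbourBefore conn {x} {y} {w} x<w y<w y≢x x~w with adj? x y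
  ... | yes x~y = y , y<w , x~y
  ... | no x≁y with earlierNeighbour conn ry<lx
    where
    ry<lx : right y <ℚ left x
    ry<lx = ℚ.≰⇒> (λ lx≤ry → x≁y (adjacent (y≢x ∘ ≡-sym) lx≤ry
                    (ℚ.≤-trans (ordered y w (<⇒≤ y<w)) (proj₂ (intersect x~w)))))
  ...   | z , z<x , x~z = z , <-trans z<x x<w , x~z

module Prefix {n} (G : Graph n) (conn : Connected G) (rep : OrderedIntervalRep G)
              (i : ℕ) (2≤i : 2 ≤ i) (i+1≤n : suc i ≤ n) where
  open IntervalGraph G rep

  i≤n : i ≤ n
  i≤n = ≤-trans (n≤1+n i) i+1≤n

  H : Graph i
  H = prefix G i i≤n

  H′ : Graph (suc i)
  H′ = prefix G (suc i) i+1≤n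

  ι : Fin i → Fin n
  ι a = inject≤ a i≤n

  w : Fin n
  w = inject≤ (fromℕ i) i+1≤n

  toℕ-w : toℕ w ≡ i
  toℕ-w = trans (toℕ-inject≤ (fromℕ i) i+1≤n) (toℕ-fromℕ i)

  ι<w : ∀ a → toℕ (ι a) < toℕ w
  ι<w a rewrite toℕ-w | toℕ-inject≤ a i≤n = toℕ<n a

  ι-injective : ∀ {a b} → ι a ≡ ι b → a ≡ b
  ι-injective {a} {b} e = toℕ-injective
    (trans (≡-sym (toℕ-inject≤ a i≤n)) (trans (cong toℕ e) (toℕ-inject≤ b i≤n)))

  ι-fromℕ< : ∀ {z} (z<i : toℕ z < i) → ι (fromℕ< z<i) ≡ z
  ι-fromℕ< {z} z<i = toℕ-injective (trans (toℕ-inject≤ (fromℕ< z<i) i≤n) (toℕ-fromℕ< z<i))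

  restrict : ∀ {a b} → Adj H′ (inject₁ a) (inject₁ b) → Adj H a b
  restrict {a} {b} = subst₂ (Adj G) (inject≤-inject₁ a i+1≤n i≤n) (inject≤-inject₁ b i+1≤n i≤n)

  toW : ∀ {a} → Adj H′ (inject₁ a) (fromℕ i) → Adj G (ι a) w
  toW {a} = subst (λ u → Adj G u w) (inject≤-inject₁ a i+1≤n i≤n)

  simplicial : ∀ {u v} → u ≢ v → Adj H′ (inject₁ u) (fromℕ i) → Adj H′ (inject₁ v) (fromℕ i) →
    Adj H u v
  simplicial {u} {v} u≢v u~w v~w = earlierNeighboursAdjacent (<⇒≤ (ι<w u)) (<⇒≤ (ι<w v))
    (u≢v ∘ ι-injective) (toW u~w) (toW v~w)

  nonIsolated : ∀ x → Adj H′ (inject₁ x) (fromℕ i) → ∃ λ z → Adj H x z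
  nonIsolated x x~w with anotherVertex 2≤i x
  ... | y , y≢x with neighbourBefore conn (ι<w x) (ι<w y) (y≢x ∘ ι-injective) (toW x~w)
  ...   | z , z<w , x~z = fromℕ< z<i , subst (Adj G (ι x)) (≡-sym (ι-fromℕ< z<i)) x~z
    where
    z<i : toℕ z < i
    z<i = subst (toℕ z <_) toℕ-w z<w

  trade : ∀ S → PairedDominating H′ S → ∃ λ T → PairedDominating H T × ∣ T ∣ ≤ ∣ S ∣
  trade = DeleteSimplicialLast.trade H H′ restrict (λ a b → adj? (ι a) (ι b)) simplicial nonIsolated

lemma3p4 : ∀ {n} (G : Graph n) → Connected G → OrderedIntervalRep G →
    ∀ i → 2 ≤ i → (i+1≤n : suc i ≤ n) →
    ∀ a b → IsPairedDomNumber (prefix G i (≤-trans (n≤1+n i) i+1≤n)) a →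
            IsPairedDomNumber (prefix G (suc i) i+1≤n) b →
    a ≤ b
lemma3p4 G conn rep i 2≤i i+1≤n a b γp[Vi]≡a γp[Vi+1]≡b =
  pairedDomNumber-mono {H = H} {H′ = H′} trade γp[Vi]≡a γp[Vi+1]≡b
  where open Prefix G conn rep i 2≤i i+1≤n
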